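{- Let $A$ and $B$ be finite sets of UTVPI constraints with integer constants, such that $A\wedge B$ is satisfiable over $\mathbb Q$ but unsatisfiable over $\mathbb Z$. Let $A',B'$ be their difference-logic encodings and let $C$ be a cycle of total weight $0$ in the constraint graph $G(A'\wedge B')$ (each edge labelled as coming from $A'$ or from $B'$; write $C_A$, $C_B$ for the $A'$- and $B'$-edges of $C$) that contains, each exactly once, the two vertices $x_i^+$ and $x_i^-$ of some variable $x_i$, such that the weight of the path from $x_i^-$ to $x_i^+$ along $C$ is odd. Suppose $x_i$ occurs in $B$ but not in $A$. Let $I'$ be the conjunction of the summary constraints of the maximal $C_A$-paths of $C$, and $I=\Upsilon(I')$. Then $I$ is an interpolant for $(A,B)$ over the integers.
   Context: A UTVPI constraint is $(0\le a x + b y + k)$ with $a,b\in\{ -1,0,1\}$. For each variable $x$ there are difference-logic variables $x^+,x^-$, with $\Upsilon(x^+)=x$, $\Upsilon(x^-)=-x$; write $v(x)=x^+$, $v(-x)=x^-$ for signed variables. Encoding: $(0\le s_1+s_2+k)$ with $s_1,s_2$ signed occurrences of distinct variables becomes $(0\le v(s_1)-v(-s_2)+k)$ and $(0\le v(s_2)-v(-s_1)+k)$; $(0\le s+k)$ becomes $(0\le v(s)-v(-s)+2k)$. $\Upsilon(0\le v-u+k)=(0\le\Upsilon(v)-\Upsilon(u)+k)$, extended to conjunctions. The graph has an edge $u\xrightarrow{c}v$ per constraint $(0\le v-u+c)$. A maximal $C_A$-path is a maximal path $u_1\xrightarrow{c_1}\cdots\xrightarrow{c_{n-1}}u_n$ of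 consecutive $C_A$-edges of $C$ preceded and followed in $C$ by $C_B$-edges; its summary constraint is $(0\le u_n-u_1+\sum c_j)$. An interpolant for $(A,B)$ over the integers is a formula $I$ with $A\models I$ and $I\wedge B$ unsatisfiable (variables ranging over $\mathbb Z$), and every variable of $I$ occurring in both $A$ and $B$. -}

module Defs where

open import Data.Nat as ℕ using (ℕ; zero; suc; _<_; NonZero)
open import Data.Nat.DivMod using (_mod_)
open import Data.Nat.Properties using ()
open import Data.Integer as ℤ using (ℤ; +_)
open import Data.Rational as ℚ using (ℚ)
open import Data.Fin using (Fin; toℕ)
open import Data.List using (List; []; _∷_; concatMap)
open import Data.List.Membership.Propositional using (_∈_)
open import Data.List.Relation.Unary.Any using (Any)
open import Data.List.Relation.Unary.All using (All)
open import Data.Product using (Σ; ∃; ∃-syntax; _×_; _,_)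
open import Data.Sum using (_⊎_)
open import Data.Empty using (⊥)
open import Relation.Binary.PropositionalEquality using (_≡_; _≢_)
open import Relation.Nullary using (¬_)

Var : Set
Var = ℕ

data Sign : Set where
  plus minus : Sign

-- A signed occurrence  +x  or  -x.  The same type also serves as the
-- difference-logic variables:  x⁺ = sv plus x ,  x⁻ = sv minus x.
record SVar : Set where
  constructor sv
  field
    sign : Sign
    var  : Var
open SVar public

neg : SVar → SVar
neg (sv plus x)  = sv minus x
neg (sv minus x) = sv plus x

DVar : Set
DVar = SVar

_⁺ _⁻ : Var → DVar
x ⁺ = sv plus x
x ⁻ = sv minus x

v : SVar → DVar
v s = s

-- UTVPI constraints  (0 ≤ a x + b y + k),  a,b ∈ {-1,0,1}
-- two s₁ s₂ _ k  :  0 ≤ s₁ + s₂ + k   (distinct variables)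
-- one s k        :  0 ≤ s + k

data UTVPI : Set where
  two : (s₁ s₂ : SVar) → var s₁ ≢ var s₂ → ℤ → UTVPI
  one : (s : SVar) → ℤ → UTVPI

valZ : (Var → ℤ) → SVar → ℤ
valZ ρ (sv plus x)  = ρ x
valZ ρ (sv minus x) = ℤ.- ρ x

satZ : (Var → ℤ) → UTVPI → Set
satZ ρ (two s₁ s₂ _ k) = + 0 ℤ.≤ (valZ ρ s₁ ℤ.+ valZ ρ s₂) ℤ.+ k
satZ ρ (one s k)       = + 0 ℤ.≤ valZ ρ s ℤ.+ k

ℤ→ℚ : ℤ → ℚ
ℤ→ℚ k = k ℚ./ 1

valQ : (Var → ℚ) → SVar → ℚ
valQ ρ (sv plus x)  = ρ x
valQ ρ (sv minus x) = ℚ.- ρ x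

satQ : (Var → ℚ) → UTVPI → Set
satQ ρ (two s₁ s₂ _ k) = ℚ.0ℚ ℚ.≤ (valQ ρ s₁ ℚ.+ valQ ρ s₂) ℚ.+ ℤ→ℚ k
satQ ρ (one s k)       = ℚ.0ℚ ℚ.≤ valQ ρ s ℚ.+ ℤ→ℚ k

SatZ : (Var → ℤ) → List UTVPI → Set
SatZ ρ A = All (satZ ρ) A

SatQ : (Var → ℚ) → List UTVPI → Set
SatQ ρ A = All (satQ ρ) A

occurs : Var → UTVPI → Set
occurs x (two s₁ s₂ _ _) = var s₁ ≡ x ⊎ var s₂ ≡ x
occurs x (one s _)       = var s ≡ x

OccursIn : Var → List UTVPI → Set
OccursIn x A = Any (occurs x) A

-- Difference-logic constraints  dl w u k  :  (0 ≤ w - u + k)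

record DL : Set where
  constructor dl
  field
    hi lo : DVar
    const : ℤ
open DL public

encode : UTVPI → List DL
encode (two s₁ s₂ _ k) = dl (v s₁) (v (neg s₂)) k ∷ dl (v s₂) (v (neg s₁)) k ∷ []
encode (one s k)       = dl (v s) (v (neg s)) (+ 2 ℤ.* k) ∷ []

encodeAll : List UTVPI → List DL
encodeAll = concatMap encode

-- Υ : Υ(x⁺) = x, Υ(x⁻) = -x ;  Υ(0 ≤ w - u + k) = (0 ≤ Υ(w) - Υ(u) + k)
-- semantics of Υ(c) over ℤ
satΥ : (Var → ℤ) → DL → Set
satΥ ρ (dl w u k) = + 0 ℤ.≤ (valZ ρ w ℤ.- valZ ρ u) ℤ.+ k

-- variables occurring in Υ(0 ≤ w - u + k): none if w = u (the terms
-- cancel), otherwise the variables of w and u.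
varsΥ : Var → DL → Set
varsΥ x (dl w u _) = w ≢ u × (var w ≡ x ⊎ var u ≡ x)

data Side : Set where
  sideA sideB : Side

-- edge  src --w--> tgt  for the constraint  (0 ≤ tgt - src + w)
record Edge : Set where
  constructor edge
  field
    src tgt : DVar
    w       : ℤ
    side    : Side
open Edge public

InGraph : (A' B' : List DL) → Edge → Set
InGraph A' B' (edge u t c sideA) = dl t u c ∈ A'
InGraph A' B' (edge u t c sideB) = dl t u c ∈ B'

-- A closed walk (cycle) of n ≥ 1 edges, given as E : Fin n → Edge with
-- indices read cyclically.
module Cycle (n : ℕ) .{{_ : NonZero n}} (E : Fin n → Edge) where

  at : ℕ → Edge
  at j = E (j mod n)

  IsCycle : Set
  IsCycle = ∀ j → tgt (at j) ≡ src (at (suc j))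

  segW : ℕ → ℕ → ℤ
  segW j zero    = + 0
  segW j (suc l) = w (at j) ℤ.+ segW (suc j) l

  totalWeight : ℤ
  totalWeight = segW 0 n

  ExactlyOnce : DVar → Set
  ExactlyOnce d = ∃[ j ] (src (E j) ≡ d × (∀ j′ → src (E j′) ≡ d → j′ ≡ j))

  -- the segment of m ≥ 1 edges starting at j is a maximal C_A-path:
  -- all its edges are A-edges, and the edges just before and just
  -- after it are B-edges
  MaximalAPath : ℕ → ℕ → Set
  MaximalAPath j m =
    j < n × 0 < m ×
    (∀ t → t < m → side (at (j ℕ.+ t)) ≡ sideA) ×
    side (at (j ℕ.+ (n ℕ.∸ 1))) ≡ sideB ×
    side (at (j ℕ.+ m)) ≡ sideB

  summary : ℕ → ℕ → DL
  summary j m = dl (tgt (at (j ℕ.+ (m ℕ.∸ 1)))) (src (at j)) (segW j m)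

  SatI : (Var → ℤ) → Set
  SatI ρ = ∀ j m → MaximalAPath j m → satΥ ρ (summary j m)

  VarOfI : Var → Set
  VarOfI x = ∃[ j ] ∃[ m ] (MaximalAPath j m × varsΥ x (summary j m))

Odd : ℤ → Set
Odd z = ∃[ k ] z ≡ + 1 ℤ.+ + 2 ℤ.* k

-- Each Υ-image of an encoded constraint is implied by the UTVPI constraint it encodes, and along
-- any walk of the cycle these images telescope: the edges from position j to j + l together give
-- Υ(0 ≤ u_{j+l} − u_j + weight). Hence A implies the summary of every maximal C_A-path. Since x
-- does not occur in A, the edges of C entering and leaving x⁺ and x⁻ are B-edges, so each of the
-- two arcs of C between x⁻ and x⁺ splits into maximal C_A-paths and single B-edges. Under I ∧ B
-- the arcs give 0 ≤ 2x + w and 0 ≤ −2x − w, where w is the odd weight of the arc from x⁻ to x⁺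
-- (the cycle has weight 0); so 2x + w = 0, which no integer x satisfies. Finally, both endpoints
-- of a maximal C_A-path lie on an A-edge and on a B-edge, so they occur in A and in B.
module Submission where

open import Defs
open import Data.Nat using (ℕ; zero; suc; _<_; _+_; _∸_; _%_; z≤n; s≤s; NonZero)
open import Data.Integer as ℤ using (ℤ; +_; -[1+_])
open import Data.Rational using (ℚ)
open import Data.Fin using (Fin)
open import Data.List using (List; []; _∷_)
open import Data.Product using (∃-syntax; _×_; _,_; proj₁; proj₂)
open import Relation.Binary.PropositionalEquality
  using (_≡_; _≢_; refl; sym; trans; cong; cong₂; subst; subst₂; module ≡-Reasoning)
open import Relation.Nullary using (¬_)

import Data.Nat.Properties as ℕ
open import Data.Nat.DivMod using (%-distribˡ-+; m%n%n≡m%n; [m+n]%n≡m%n; m%n<n)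
import Data.Nat.Tactic.RingSolver as ℕ-Solver
import Data.Integer.Properties as ℤ
open import Data.Integer.Tactic.RingSolver using (solve-∀)
open import Algebra.Properties.AbelianGroup ℤ.+-0-abelianGroup using (∙-cancelˡ)
open import Data.Fin.Properties using (fromℕ<-cong)
open import Data.List.Relation.Unary.All as All using (All; []; _∷_)
open import Data.List.Relation.Unary.All.Properties using (++⁺)
open import Data.List.Relation.Unary.Any using (here; there)
open import Data.List.Membership.Propositional using (_∈_)
open import Data.Sum using (inj₁; inj₂)
open import Data.Empty using (⊥; ⊥-elim)
open import Function using (_∘_)

open ≡-Reasoning

var-neg : ∀ s → var (neg s) ≡ var s
var-neg (sv plus _)  = refl
var-neg (sv minus _) = refl

valZ-neg : ∀ ρ s → valZ ρ (neg s) ≡ ℤ.- valZ ρ s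
valZ-neg ρ (sv plus _)  = refl
valZ-neg ρ (sv minus x) = sym (ℤ.neg-involutive (ρ x))

i-valZ-neg≡i+valZ : ∀ ρ i s → i ℤ.- valZ ρ (neg s) ≡ i ℤ.+ valZ ρ s
i-valZ-neg≡i+valZ ρ i s = cong (ℤ._+_ i) (trans (cong ℤ.-_ (valZ-neg ρ s)) (ℤ.neg-involutive _))

encode-sound : ∀ ρ c → satZ ρ c → All (satΥ ρ) (encode c)
encode-sound ρ (two s₁ s₂ _ k) h =
  subst (λ i → + 0 ℤ.≤ i ℤ.+ k) (sym (i-valZ-neg≡i+valZ ρ (valZ ρ s₁) s₂)) h ∷
  subst (λ i → + 0 ℤ.≤ i ℤ.+ k)
    (trans (ℤ.+-comm (valZ ρ s₁) _) (sym (i-valZ-neg≡i+valZ ρ (valZ ρ s₂) s₁))) h ∷ []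
encode-sound ρ (one s k) h =
  subst (+ 0 ℤ.≤_)
    (trans (double (valZ ρ s) k) (cong (ℤ._+ + 2 ℤ.* k) (sym (i-valZ-neg≡i+valZ ρ (valZ ρ s) s))))
    (ℤ.+-mono-≤ h h) ∷ []
  where
  double : ∀ a k → (a ℤ.+ k) ℤ.+ (a ℤ.+ k) ≡ (a ℤ.+ a) ℤ.+ + 2 ℤ.* k
  double = solve-∀

encodeAll-sound : ∀ ρ L → SatZ ρ L → All (satΥ ρ) (encodeAll L)
encodeAll-sound ρ []       []       = []
encodeAll-sound ρ (c ∷ cs) (h ∷ hs) = ++⁺ (encode-sound ρ c h) (encodeAll-sound ρ cs hs)

encodeAll-occurs : ∀ L {c} → c ∈ encodeAll L → OccursIn (var (hi c)) L × OccursIn (var (lo c)) L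
encodeAll-occurs (two s₁ s₂ _ _ ∷ _) (here refl) =
  here (inj₁ refl) , here (inj₂ (sym (var-neg s₂)))
encodeAll-occurs (two s₁ s₂ _ _ ∷ _) (there (here refl)) =
  here (inj₂ refl) , here (inj₁ (sym (var-neg s₁)))
encodeAll-occurs (one s _ ∷ _) (here refl) = here refl , here (sym (var-neg s))
encodeAll-occurs (two _ _ _ _ ∷ cs) (there (there c∈)) =
  let occ₁ , occ₂ = encodeAll-occurs cs c∈ in there occ₁ , there occ₂
encodeAll-occurs (one _ _ ∷ cs) (there c∈) =
  let occ₁ , occ₂ = encodeAll-occurs cs c∈ in there occ₁ , there occ₂

Odd⇒≢0 : ∀ {z} → Odd z → z ≢ + 0
Odd⇒≢0 (k , refl) 1+2k≡0 = 1+[k+k]≢0 k (trans (cong (ℤ._+_ (+ 1)) (sym (2*k≡k+k k))) 1+2k≡0)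
  where
  2*k≡k+k : ∀ k → + 2 ℤ.* k ≡ k ℤ.+ k
  2*k≡k+k = solve-∀
  1+[k+k]≢0 : ∀ k → + 1 ℤ.+ (k ℤ.+ k) ≢ + 0
  1+[k+k]≢0 (+ zero)    ()
  1+[k+k]≢0 (+ (suc _)) ()
  1+[k+k]≢0 -[1+ _ ]    ()

Odd-double+ : ∀ i {z} → Odd z → Odd ((i ℤ.- ℤ.- i) ℤ.+ z)
Odd-double+ i (k , refl) = i ℤ.+ k , regroup i k
  where
  regroup : ∀ i k → (i ℤ.- ℤ.- i) ℤ.+ (+ 1 ℤ.+ + 2 ℤ.* k) ≡ + 1 ℤ.+ + 2 ℤ.* (i ℤ.+ k)
  regroup = solve-∀

nonneg-+≡0⇒≡0 : ∀ {i j} → + 0 ℤ.≤ i → + 0 ℤ.≤ j → i ℤ.+ j ≡ + 0 → i ≡ + 0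
nonneg-+≡0⇒≡0 {i} {j} 0≤i 0≤j i+j≡0 =
  ℤ.≤-antisym (subst₂ ℤ._≤_ (ℤ.+-identityʳ i) i+j≡0 (ℤ.+-monoʳ-≤ i 0≤j)) 0≤i

[u-v+w₁]+[v-u+w₂]≡w₁+w₂ : ∀ u v w₁ w₂ →
  ((u ℤ.- v) ℤ.+ w₁) ℤ.+ ((v ℤ.- u) ℤ.+ w₂) ≡ w₁ ℤ.+ w₂
[u-v+w₁]+[v-u+w₂]≡w₁+w₂ = solve-∀

constraintOf : Edge → DL
constraintOf e = dl (tgt e) (src e) (w e)

module CycleIndexing (n : ℕ) .{{_ : NonZero n}} (E : Fin n → Edge) where

  open Cycle n E

  %-cong-+ : ∀ {i j} t → i % n ≡ j % n → (i + t) % n ≡ (j + t) % n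
  %-cong-+ {i} {j} t i≡j = begin
    (i + t) % n           ≡⟨ %-distribˡ-+ i t n ⟩
    (i % n + t % n) % n   ≡⟨ cong (λ r → (r + t % n) % n) i≡j ⟩
    (j % n + t % n) % n   ≡⟨ %-distribˡ-+ j t n ⟨
    (j + t) % n           ∎

  %-cong-suc : ∀ {i j} → i % n ≡ j % n → suc i % n ≡ suc j % n
  %-cong-suc {i} {j} i≡j =
    subst₂ (λ a b → a % n ≡ b % n) (ℕ.+-comm i 1) (ℕ.+-comm j 1) (%-cong-+ 1 i≡j)

  [i+pred[n]]+1≡i+n : ∀ i → suc (i + (n ∸ 1)) ≡ i + n
  [i+pred[n]]+1≡i+n i = trans (sym (ℕ.+-suc i (n ∸ 1))) (cong (_+_ i) (ℕ.suc-pred n))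

  at-cong : ∀ {i j} → i % n ≡ j % n → at i ≡ at j
  at-cong i≡j = cong E (fromℕ<-cong _ _ i≡j _ _)

  at-+n : ∀ i → at (i + n) ≡ at i
  at-+n i = at-cong ([m+n]%n≡m%n i n)

  at-suc-+pred : ∀ i → at (suc (i + (n ∸ 1))) ≡ at i
  at-suc-+pred i = trans (cong at ([i+pred[n]]+1≡i+n i)) (at-+n i)

  at-%-+ : ∀ i t → at (i % n + t) ≡ at (i + t)
  at-%-+ i t = at-cong (%-cong-+ t (m%n%n≡m%n i n))

  segW-cong : ∀ {i j} → i % n ≡ j % n → ∀ l → segW i l ≡ segW j l
  segW-cong i≡j zero    = refl
  segW-cong i≡j (suc l) = cong₂ ℤ._+_ (cong w (at-cong i≡j)) (segW-cong (%-cong-suc i≡j) l)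

  segW-++ : ∀ j a b → segW j (a + b) ≡ segW j a ℤ.+ segW (j + a) b
  segW-++ j zero    b = trans (cong (λ k → segW k b) (sym (ℕ.+-identityʳ j))) (sym (ℤ.+-identityˡ _))
  segW-++ j (suc a) b = begin
    w (at j) ℤ.+ segW (suc j) (a + b)
      ≡⟨ cong (ℤ._+_ (w (at j))) (segW-++ (suc j) a b) ⟩
    w (at j) ℤ.+ (segW (suc j) a ℤ.+ segW (suc j + a) b)
      ≡⟨ ℤ.+-assoc (w (at j)) _ _ ⟨
    segW j (suc a) ℤ.+ segW (suc j + a) b
      ≡⟨ cong (λ k → segW j (suc a) ℤ.+ segW k b) (ℕ.+-suc j a) ⟨
    segW j (suc a) ℤ.+ segW (j + suc a) b
      ∎

  segW-rotate : ∀ j → segW j n ≡ totalWeight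
  segW-rotate zero    = refl
  segW-rotate (suc j) = trans (∙-cancelˡ (w (at j)) _ _ step) (segW-rotate j)
    where
    step : w (at j) ℤ.+ segW (suc j) n ≡ w (at j) ℤ.+ segW j n
    step = begin
      segW j (1 + n)                ≡⟨ cong (segW j) (ℕ.+-comm 1 n) ⟩
      segW j (n + 1)                ≡⟨ segW-++ j n 1 ⟩
      segW j n ℤ.+ segW (j + n) 1   ≡⟨ cong (ℤ._+_ (segW j n)) (segW-cong ([m+n]%n≡m%n j n) 1) ⟩
      segW j n ℤ.+ segW j 1         ≡⟨ cong (ℤ._+_ (segW j n)) (ℤ.+-identityʳ _) ⟩
      segW j n ℤ.+ w (at j)         ≡⟨ ℤ.+-comm (segW j n) (w (at j)) ⟩
      w (at j) ℤ.+ segW j n         ∎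

module CycleWalks (n : ℕ) .{{_ : NonZero n}} (E : Fin n → Edge) (cyc : Cycle.IsCycle n E) where

  open Cycle n E
  open CycleIndexing n E

  walkSummary : ℕ → ℕ → DL
  walkSummary j l = dl (src (at (j + l))) (src (at j)) (segW j l)

  tgt-before : ∀ i → tgt (at (i + (n ∸ 1))) ≡ src (at i)
  tgt-before i = trans (cyc (i + (n ∸ 1))) (cong src (at-suc-+pred i))

  tgt≡src-next : ∀ j m → tgt (at (j + m)) ≡ src (at (j + suc m))
  tgt≡src-next j m = trans (cyc (j + m)) (cong (src ∘ at) (sym (ℕ.+-suc j m)))

  summary≡walkSummary : ∀ j m → summary j (suc m) ≡ walkSummary j (suc m)
  summary≡walkSummary j m =
    cong (λ u → dl u (src (at j)) (segW j (suc m))) (tgt≡src-next j m)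

  walkSummary-cong : ∀ {i j} → i % n ≡ j % n → ∀ l → walkSummary i l ≡ walkSummary j l
  walkSummary-cong i≡j l rewrite at-cong i≡j | at-cong (%-cong-+ l i≡j) | segW-cong i≡j l = refl

  module _ (ρ : Var → ℤ) where

    walkSummary-[] : ∀ j → satΥ ρ (walkSummary j 0)
    walkSummary-[] j rewrite ℕ.+-identityʳ j =
      subst (+ 0 ℤ.≤_) (sym (trans (ℤ.+-identityʳ _) (ℤ.+-inverseʳ (valZ ρ (src (at j)))))) ℤ.≤-refl

    walkSummary-++ : ∀ {j} a b → satΥ ρ (walkSummary j a) → satΥ ρ (walkSummary (j + a) b) →
                     satΥ ρ (walkSummary j (a + b))
    walkSummary-++ {j} a b h₁ h₂ = subst (+ 0 ℤ.≤_) sum-telescopes (ℤ.+-mono-≤ h₁ h₂)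
      where
      val : ℕ → ℤ
      val i = valZ ρ (src (at i))
      sum-telescopes :
        ((val (j + a) ℤ.- val j) ℤ.+ segW j a) ℤ.+
        ((val (j + a + b) ℤ.- val (j + a)) ℤ.+ segW (j + a) b) ≡
        (val (j + (a + b)) ℤ.- val j) ℤ.+ segW j (a + b)
      sum-telescopes = begin
        _ ≡⟨ telescope (val j) (val (j + a)) (val (j + a + b)) (segW j a) (segW (j + a) b) ⟩
        (val (j + a + b) ℤ.- val j) ℤ.+ (segW j a ℤ.+ segW (j + a) b)
          ≡⟨ cong₂ (λ i s → (val i ℤ.- val j) ℤ.+ s) (ℕ.+-assoc j a b) (sym (segW-++ j a b)) ⟩
        _ ∎
        where
        telescope : ∀ u₀ u₁ u₂ s₁ s₂ →
          ((u₁ ℤ.- u₀) ℤ.+ s₁) ℤ.+ ((u₂ ℤ.- u₁) ℤ.+ s₂) ≡ (u₂ ℤ.- u₀) ℤ.+ (s₁ ℤ.+ s₂)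
        telescope = solve-∀

    walkSummary-∷ : ∀ {j} l → satΥ ρ (walkSummary j 1) → satΥ ρ (walkSummary (suc j) l) →
                    satΥ ρ (walkSummary j (suc l))
    walkSummary-∷ {j} l h₁ h₂ =
      walkSummary-++ 1 l h₁ (subst (satΥ ρ ∘ (λ k → walkSummary k l)) (ℕ.+-comm 1 j) h₂)

    walkSummary-∷ʳ : ∀ {j} l → satΥ ρ (walkSummary j l) → satΥ ρ (walkSummary (j + l) 1) →
                     satΥ ρ (walkSummary j (suc l))
    walkSummary-∷ʳ {j} l h₁ h₂ =
      subst (satΥ ρ ∘ walkSummary j) (ℕ.+-comm l 1) (walkSummary-++ l 1 h₁ h₂)

    walkSummary-edge : ∀ i → satΥ ρ (constraintOf (at i)) → satΥ ρ (walkSummary i 1)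
    walkSummary-edge i =
      subst₂ (λ u c → + 0 ℤ.≤ (valZ ρ u ℤ.- valZ ρ (src (at i))) ℤ.+ c)
        (trans (cyc i) (cong (src ∘ at) (ℕ.+-comm 1 i))) (sym (ℤ.+-identityʳ _))

module Interpolation (A B : List UTVPI) (n : ℕ) .{{_ : NonZero n}} (E : Fin n → Edge)
  (inG : ∀ j → InGraph (encodeAll A) (encodeAll B) (E j)) (cyc : Cycle.IsCycle n E) where

  open Cycle n E
  open CycleIndexing n E
  open CycleWalks n E cyc

  origin : Side → List UTVPI
  origin sideA = A
  origin sideB = B

  InGraph⇒∈origin : ∀ e → InGraph (encodeAll A) (encodeAll B) e →
                    constraintOf e ∈ encodeAll (origin (side e))
  InGraph⇒∈origin (edge _ _ _ sideA) e∈ = e∈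
  InGraph⇒∈origin (edge _ _ _ sideB) e∈ = e∈

  at∈origin : ∀ i → constraintOf (at i) ∈ encodeAll (origin (side (at i)))
  at∈origin i = InGraph⇒∈origin (at i) (inG _)

  IsB : ℕ → Set
  IsB i = side (at i) ≡ sideB

  AllAEdges : ℕ → ℕ → Set
  AllAEdges j a = ∀ t → t < a → side (at (j + t)) ≡ sideA

  edge-sound : ∀ ρ {s} i → side (at i) ≡ s → SatZ ρ (origin s) → satΥ ρ (walkSummary i 1)
  edge-sound ρ i refl sat = walkSummary-edge ρ i (All.lookup (encodeAll-sound ρ _ sat) (at∈origin i))

  tgt-occurs : ∀ {s} i → side (at i) ≡ s → OccursIn (var (tgt (at i))) (origin s)
  tgt-occurs i refl = proj₁ (encodeAll-occurs _ (at∈origin i))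

  src-occurs : ∀ {s} i → side (at i) ≡ s → OccursIn (var (src (at i))) (origin s)
  src-occurs i refl = proj₂ (encodeAll-occurs _ (at∈origin i))

  A-path-sound : ∀ ρ → SatZ ρ A → ∀ j m → AllAEdges j m → satΥ ρ (walkSummary j m)
  A-path-sound ρ sat j zero    _    = walkSummary-[] ρ j
  A-path-sound ρ sat j (suc m) allA =
    walkSummary-∷ʳ ρ m (A-path-sound ρ sat j m (λ t t<m → allA t (ℕ.m<n⇒m<1+n t<m)))
      (edge-sound ρ (j + m) (allA m (ℕ.n<1+n m)) sat)

  A⊨I : ∀ ρ → SatZ ρ A → SatI ρ
  A⊨I ρ sat j (suc m) (_ , _ , allA , _ , _) =
    subst (satΥ ρ) (sym (summary≡walkSummary j m)) (A-path-sound ρ sat j (suc m) allA)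

  I-vars-shared : ∀ y → VarOfI y → OccursIn y A × OccursIn y B
  I-vars-shared y (j , suc m , (_ , _ , allA , _ , after) , _ , inj₁ last≡y) =
    subst (λ z → OccursIn z A) last≡y (tgt-occurs (j + m) (allA m (ℕ.n<1+n m))) ,
    subst (λ z → OccursIn z B) (trans (cong var (sym (tgt≡src-next j m))) last≡y)
      (src-occurs (j + suc m) after)
  I-vars-shared y (j , suc m , (_ , _ , allA , before , _) , _ , inj₂ first≡y) =
    subst (λ z → OccursIn z A) (trans (cong (var ∘ src ∘ at) (ℕ.+-identityʳ j)) first≡y)
      (src-occurs (j + 0) (allA 0 (s≤s z≤n))) ,
    subst (λ z → OccursIn z B) (trans (cong var (tgt-before j)) first≡y) (tgt-occurs (j + (n ∸ 1)) before)

  module _ (ρ : Var → ℤ) (satI : SatI ρ) (satB : SatZ ρ B) where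

    A-path-from-I : ∀ {j} a → IsB (j + (n ∸ 1)) → AllAEdges j a → IsB (j + a) →
                    satΥ ρ (walkSummary j a)
    A-path-from-I {j} zero    _      _    _     = walkSummary-[] ρ j
    A-path-from-I {j} (suc m) before allA after =
      subst (satΥ ρ) (trans (summary≡walkSummary (j % n) m) (walkSummary-cong (m%n%n≡m%n j n) (suc m)))
        (satI (j % n) (suc m) maximal)
      where
      side-%-+ : ∀ t → side (at (j % n + t)) ≡ side (at (j + t))
      side-%-+ t = cong side (at-%-+ j t)
      maximal : MaximalAPath (j % n) (suc m)
      maximal = m%n<n j n , s≤s z≤n , (λ t t<m → trans (side-%-+ t) (allA t t<m)) ,
                trans (side-%-+ (n ∸ 1)) before , trans (side-%-+ (suc m)) after

    -- a counts the A-edges crossed since the last B-edge; generalising over it makes the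
    -- recursion structural in l.
    B-bounded-walk : ∀ l {j a} → IsB (j + (n ∸ 1)) → AllAEdges j a → IsB (j + (a + l)) →
                     satΥ ρ (walkSummary j (a + l))
    B-bounded-walk zero {j} {a} before allA after =
      subst (satΥ ρ ∘ walkSummary j) (sym (ℕ.+-identityʳ a))
        (A-path-from-I a before allA (subst (IsB ∘ (_+_ j)) (ℕ.+-identityʳ a) after))
    B-bounded-walk (suc l) {j} {a} before allA after with side (at (j + a)) in edge-j+a
    ... | sideA =
      subst (satΥ ρ ∘ walkSummary j) (sym (ℕ.+-suc a l))
        (B-bounded-walk l before allA′ (subst (IsB ∘ (_+_ j)) (ℕ.+-suc a l) after))
      where
      allA′ : AllAEdges j (suc a)
      allA′ t t≤a with ℕ.m<1+n⇒m<n∨m≡n t≤a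
      ... | inj₁ t<a  = allA t t<a
      ... | inj₂ refl = edge-j+a
    ... | sideB =
      walkSummary-++ ρ a (suc l) (A-path-from-I a before allA edge-j+a)
        (walkSummary-∷ ρ l (edge-sound ρ (j + a) edge-j+a satB)
          (B-bounded-walk l {suc (j + a)} {0} before′ (λ _ ()) (subst IsB (shift j a l) after)))
      where
      before′ : IsB (suc (j + a) + (n ∸ 1))
      before′ = trans (cong side (at-suc-+pred (j + a))) edge-j+a
      shift : ∀ j a l → j + (a + suc l) ≡ suc (j + a) + l
      shift = ℕ-Solver.solve-∀

  module _ (x : Var) (x∉A : ¬ OccursIn x A) where

    x∈origin⇒sideB : ∀ s → OccursIn x (origin s) → s ≡ sideB
    x∈origin⇒sideB sideA x∈A = ⊥-elim (x∉A x∈A)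
    x∈origin⇒sideB sideB _   = refl

    src-x⇒IsB : ∀ i → var (src (at i)) ≡ x → IsB i
    src-x⇒IsB i src≡x = x∈origin⇒sideB _ (subst (λ z → OccursIn z _) src≡x (src-occurs i refl))

    tgt-x⇒IsB : ∀ i → var (tgt (at i)) ≡ x → IsB i
    tgt-x⇒IsB i tgt≡x = x∈origin⇒sideB _ (subst (λ z → OccursIn z _) tgt≡x (tgt-occurs i refl))

    walk-between-x : ∀ ρ → SatI ρ → SatZ ρ B → ∀ j l →
                     var (src (at j)) ≡ x → var (src (at (j + l))) ≡ x → satΥ ρ (walkSummary j l)
    walk-between-x ρ satI satB j l first≡x last≡x =
      B-bounded-walk ρ satI satB l {j} {0}
        (tgt-x⇒IsB (j + (n ∸ 1)) (trans (cong var (tgt-before j)) first≡x))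
        (λ _ ())
        (src-x⇒IsB (j + l) last≡x)

    odd-arc-unsat : ∀ ρ → SatI ρ → SatZ ρ B → totalWeight ≡ + 0 → ∀ p d → d < n →
                    src (at p) ≡ x ⁻ → src (at (p + d)) ≡ x ⁺ → Odd (segW p d) → ⊥
    odd-arc-unsat ρ satI satB total p d d<n p↦x⁻ p+d↦x⁺ odd =
      Odd⇒≢0 (Odd-double+ (ρ x) odd) (nonneg-+≡0⇒≡0 arc₁ arc₂ arcs-sum)
      where
      d+[n∸d]≡n : d + (n ∸ d) ≡ n
      d+[n∸d]≡n = ℕ.m+[n∸m]≡n (ℕ.<⇒≤ d<n)
      p+d+[n∸d]↦x⁻ : src (at (p + d + (n ∸ d))) ≡ x ⁻
      p+d+[n∸d]↦x⁻ =
        trans (cong (src ∘ at) (trans (ℕ.+-assoc p d (n ∸ d)) (cong (_+_ p) d+[n∸d]≡n)))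
          (trans (cong src (at-+n p)) p↦x⁻)
      arc₁ : + 0 ℤ.≤ (ρ x ℤ.- ℤ.- ρ x) ℤ.+ segW p d
      arc₁ = subst₂ (λ u v → + 0 ℤ.≤ (valZ ρ u ℤ.- valZ ρ v) ℤ.+ segW p d) p+d↦x⁺ p↦x⁻
               (walk-between-x ρ satI satB p d (cong var p↦x⁻) (cong var p+d↦x⁺))
      arc₂ : + 0 ℤ.≤ (ℤ.- ρ x ℤ.- ρ x) ℤ.+ segW (p + d) (n ∸ d)
      arc₂ = subst₂ (λ u v → + 0 ℤ.≤ (valZ ρ u ℤ.- valZ ρ v) ℤ.+ segW (p + d) (n ∸ d))
               p+d+[n∸d]↦x⁻ p+d↦x⁺
               (walk-between-x ρ satI satB (p + d) (n ∸ d) (cong var p+d↦x⁺) (cong var p+d+[n∸d]↦x⁻))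
      arcs-sum : _ ≡ + 0
      arcs-sum = begin
        _                                    ≡⟨ [u-v+w₁]+[v-u+w₂]≡w₁+w₂ (ρ x) (ℤ.- ρ x) _ _ ⟩
        segW p d ℤ.+ segW (p + d) (n ∸ d)    ≡⟨ segW-++ p d (n ∸ d) ⟨
        segW p (d + (n ∸ d))                 ≡⟨ cong (segW p) d+[n∸d]≡n ⟩
        segW p n                             ≡⟨ segW-rotate p ⟩
        totalWeight                          ≡⟨ total ⟩
        + 0                                  ∎

mainTheorem8 : (A B : List UTVPI) →
    (∃[ ρ ] (SatQ ρ A × SatQ ρ B)) →
    ¬ (∃[ ρ ] (SatZ ρ A × SatZ ρ B)) →
    (n : ℕ) .{{_ : NonZero n}} (E : Fin n → Edge) →
    (∀ j → InGraph (encodeAll A) (encodeAll B) (E j)) →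
    Cycle.IsCycle n E →
    Cycle.totalWeight n E ≡ + 0 →
    (x : Var) →
    Cycle.ExactlyOnce n E (x ⁺) →
    Cycle.ExactlyOnce n E (x ⁻) →
    (∃[ p ] ∃[ d ] (p < n × d < n ×
        src (Cycle.at n E p) ≡ x ⁻ ×
        src (Cycle.at n E (p + d)) ≡ x ⁺ ×
        Odd (Cycle.segW n E p d))) →
    OccursIn x B →
    ¬ OccursIn x A →
    (∀ (ρ : Var → ℤ) → SatZ ρ A → Cycle.SatI n E ρ) ×
    ¬ (∃[ ρ ] (Cycle.SatI n E ρ × SatZ ρ B)) ×
    (∀ y → Cycle.VarOfI n E y → OccursIn y A × OccursIn y B)
mainTheorem8 A B _ _ n E inG cyc total x _ _ (p , d , _ , d<n , p↦x⁻ , p+d↦x⁺ , odd) _ x∉A =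
  A⊨I ,
  (λ (ρ , satI , satB) → odd-arc-unsat x x∉A ρ satI satB total p d d<n p↦x⁻ p+d↦x⁺ odd) ,
  I-vars-shared
  where
  open Interpolation A B n E inG cyc
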